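{- Let $X,Y,Z$ be finite simple graphs, and let the cells, the minimum dominating set $D$ of $X\square Y\square Z$, and the cell coloring be as described in the context. Then \[ b'+g'+y'+o'+r'+p'\geq \gamma (X) \gamma (Z) |V(Y)|. \]
   Context: Graphs are finite and simple; $\gamma(G)$ is the domination number; $X\square Y$ is the Cartesian product (vertex set $V(X)\times V(Y)$, $(x_1,y_1)\sim(x_2,y_2)$ iff $x_1=x_2$ and $y_1y_2\in E(Y)$, or $y_1=y_2$ and $x_1x_2\in E(X)$). Let $k=\gamma(X)$, let $\{u_1,\dots,u_k\}$ be a minimum dominating set of $X$, and let $\{\pi_1,\dots,\pi_k\}$ be a partition of $V(X)$ with $u_i\in\pi_i\subseteq N[u_i]$ for each $i$, where $N[x]$ is the closed neighborhood of $x$ in $X$. For $i\in\{1,\dots,k\}$, $y\in V(Y)$, $z\in V(Z)$, the cell $\pi_i^{y,z}=\{(a,y,z): a\in\pi_i\}\subseteq V(X\square Y\square Z)$; the cells partition $V(X\square Y\square Z)$. Let $D$ be a minimum dominating set of $X\square Y\square Z$. A vertex $(a,b,c)$ is $X$-dominated if some $(a',b,c)\in D$ with $a'=a$ or $a'a\in E(X)$; $Y$-dominated if some $(a,b',c)\in D$ with $b'b\in E(Y)$; $Z$-dominated if some $(a,b,c')\in D$ with $c'c\in E(Z)$. Cells containing a vertex of $D$ are colored: blue if no vertex of the cell is $Y$-dominated or $Z$-dominated; otherwise green if no vertex is $Z$-dominated; otherwise yellow if no vertex is $Y$-dominated; otherwise orange. Cells containing no vertex of $D$ are colored: red if no vertex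 is $Y$-dominated or $Z$-dominated; otherwise pink if no vertex is $Z$-dominated; otherwise maroon if no vertex is $Y$-dominated; otherwise white. Let $b',g',y',o',r',p',m',w'$ be the total numbers of blue, green, yellow, orange, red, pink, maroon, white cells respectively. -}

module Defs where

open import Data.Nat using (ℕ; zero; suc; _+_; _*_; _≤_)
open import Data.Bool using (Bool; true; false; _∧_; _∨_; not; if_then_else_)
open import Data.Fin using (Fin; _≟_)
import Data.Fin as F
open import Data.Product using (Σ; ∃; _×_; _,_)
open import Data.Sum using (_⊎_)
open import Relation.Nullary.Decidable using (⌊_⌋)
open import Relation.Binary.PropositionalEquality using (_≡_)

record Graph : Set where
  field
    nV  : ℕ
    adj : Fin nV → Fin nV → Bool
open Graph public

IsSimple : Graph → Set
IsSimple G = (∀ u v → adj G u v ≡ adj G v u) × (∀ v → adj G v v ≡ false)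

infix 5 _==_
_==_ : ∀ {n} → Fin n → Fin n → Bool
i == j = ⌊ i ≟ j ⌋

closedNbr : (G : Graph) → Fin (nV G) → Fin (nV G) → Bool
closedNbr G u v = (u == v) ∨ adj G u v

countFin : ∀ n → (Fin n → Bool) → ℕ
countFin zero    f = 0
countFin (suc n) f = (if f F.zero then 1 else 0) + countFin n (λ i → f (F.suc i))

sumFin : ∀ n → (Fin n → ℕ) → ℕ
sumFin zero    f = 0
sumFin (suc n) f = f F.zero + sumFin n (λ i → f (F.suc i))

anyFin : ∀ n → (Fin n → Bool) → Bool
anyFin zero    f = false
anyFin (suc n) f = f F.zero ∨ anyFin n (λ i → f (F.suc i))

IsDominating : (G : Graph) → (Fin (nV G) → Bool) → Set
IsDominating G S = ∀ v → ∃ λ u → S u ≡ true × closedNbr G u v ≡ true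

IsMinDominating : (G : Graph) → (Fin (nV G) → Bool) → Set
IsMinDominating G S =
  IsDominating G S × (∀ T → IsDominating G T → countFin (nV G) S ≤ countFin (nV G) T)

IsDominationNumber : Graph → ℕ → Set
IsDominationNumber G m =
  Σ (Fin (nV G) → Bool) λ S → IsMinDominating G S × countFin (nV G) S ≡ m

module Triple (X Y Z : Graph) where

  V3 : Set
  V3 = Fin (nV X) × Fin (nV Y) × Fin (nV Z)

  adj3 : V3 → V3 → Bool
  adj3 (a , b , c) (a' , b' , c') =
      (adj X a a' ∧ (b == b') ∧ (c == c'))
    ∨ ((a == a') ∧ adj Y b b' ∧ (c == c'))
    ∨ ((a == a') ∧ (b == b') ∧ adj Z c c')

  eq3 : V3 → V3 → Bool
  eq3 (a , b , c) (a' , b' , c') = (a == a') ∧ (b == b') ∧ (c == c')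

  count3 : (V3 → Bool) → ℕ
  count3 S = sumFin (nV X) λ a → sumFin (nV Y) λ b → countFin (nV Z) λ c → S (a , b , c)

  IsDominating3 : (V3 → Bool) → Set
  IsDominating3 D = ∀ v → ∃ λ u → D u ≡ true × (eq3 u v ∨ adj3 u v) ≡ true

  IsMinDominating3 : (V3 → Bool) → Set
  IsMinDominating3 D = IsDominating3 D × (∀ D' → IsDominating3 D' → count3 D ≤ count3 D')

  module Dom (D : V3 → Bool) where

    XDom : V3 → Bool
    XDom (a , b , c) = anyFin (nV X) λ a' → D (a' , b , c) ∧ closedNbr X a' a

    YDom : V3 → Bool
    YDom (a , b , c) = anyFin (nV Y) λ b' → D (a , b' , c) ∧ adj Y b' b

    ZDom : V3 → Bool
    ZDom (a , b , c) = anyFin (nV Z) λ c' → D (a , b , c') ∧ adj Z c' c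

    -- Cells π_i^{y,z} for a partition given by π : V(X) → Fin k
    -- (vertex a lies in π_i iff π a ≡ i)
    module Cells {k : ℕ} (π : Fin (nV X) → Fin k) where

      cellAny : (V3 → Bool) → Fin k → Fin (nV Y) → Fin (nV Z) → Bool
      cellAny P i y z = anyFin (nV X) λ a → (π a == i) ∧ P (a , y , z)

      hasD hasY hasZ : Fin k → Fin (nV Y) → Fin (nV Z) → Bool
      hasD = cellAny D
      hasY = cellAny YDom
      hasZ = cellAny ZDom

      blue green yellow orange red pink maroon white :
        Fin k → Fin (nV Y) → Fin (nV Z) → Bool
      blue   i y z = hasD i y z ∧ not (hasY i y z) ∧ not (hasZ i y z)
      green  i y z = hasD i y z ∧ hasY i y z ∧ not (hasZ i y z)
      yellow i y z = hasD i y z ∧ not (hasY i y z) ∧ hasZ i y z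
      orange i y z = hasD i y z ∧ hasY i y z ∧ hasZ i y z
      red    i y z = not (hasD i y z) ∧ not (hasY i y z) ∧ not (hasZ i y z)
      pink   i y z = not (hasD i y z) ∧ hasY i y z ∧ not (hasZ i y z)
      maroon i y z = not (hasD i y z) ∧ not (hasY i y z) ∧ hasZ i y z
      white  i y z = not (hasD i y z) ∧ hasY i y z ∧ hasZ i y z

      countCells : (Fin k → Fin (nV Y) → Fin (nV Z) → Bool) → ℕ
      countCells C = sumFin k λ i → sumFin (nV Y) λ y → countFin (nV Z) λ z → C i y z

      b′ g′ y′ o′ r′ p′ m′ w′ : ℕ
      b′ = countCells blue
      g′ = countCells green
      y′ = countCells yellow
      o′ = countCells orange
      r′ = countCells red
      p′ = countCells pink
      m′ = countCells maroon
      w′ = countCells white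

module Submission where

-- Fix i and y.  If the cell π_i^{y,z} contains no vertex of D but is Z-dominated,
-- say by (a, y, c) ∈ D, then c ~ z and π_i^{y,c} contains a vertex of D.  So the
-- z for which π_i^{y,z} is neither maroon nor white dominate Z, and there are at
-- least γ(Z) of them.  Summing over the k·|V(Y)| pairs (i, y) gives the bound,
-- since these cells are exactly the blue, green, yellow, orange, red and pink ones.

open import Defs
open import Algebra.Properties.CommutativeSemigroup using (interchange)
open import Data.Bool using (Bool; true; false; _∧_; _∨_; not; if_then_else_)
open import Data.Bool.Properties using (∨-zeroʳ)
open import Data.Empty using (⊥-elim)
open import Data.Fin using (Fin; _≟_)
import Data.Fin as F
open import Data.Nat using (ℕ; zero; suc; _+_; _*_; _≤_; _≥_)
open import Data.Nat.Properties
  using (+-commutativeSemigroup; +-mono-≤; ≤-refl; *-assoc; *-comm; module ≤-Reasoning)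
open import Data.Product using (∃; _×_; _,_)
open import Relation.Nullary using (yes; no)
open import Relation.Binary.PropositionalEquality
  using (_≡_; refl; sym; trans; cong; cong₂; module ≡-Reasoning)

indicator : Bool → ℕ
indicator b = if b then 1 else 0

sumFin-cong : ∀ n {f g : Fin n → ℕ} → (∀ i → f i ≡ g i) → sumFin n f ≡ sumFin n g
sumFin-cong zero    f≗g = refl
sumFin-cong (suc n) f≗g = cong₂ _+_ (f≗g F.zero) (sumFin-cong n (λ i → f≗g (F.suc i)))

sumFin-distrib-+ : ∀ n (f g : Fin n → ℕ) →
  sumFin n (λ i → f i + g i) ≡ sumFin n f + sumFin n g
sumFin-distrib-+ zero    f g = refl
sumFin-distrib-+ (suc n) f g =
  trans (cong (f F.zero + g F.zero +_) (sumFin-distrib-+ n (λ i → f (F.suc i)) (λ i → g (F.suc i))))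
        (interchange +-commutativeSemigroup (f F.zero) (g F.zero) _ _)

sumFin-mono-≤ : ∀ n {f g : Fin n → ℕ} → (∀ i → f i ≤ g i) → sumFin n f ≤ sumFin n g
sumFin-mono-≤ zero    f≤g = ≤-refl
sumFin-mono-≤ (suc n) f≤g = +-mono-≤ (f≤g F.zero) (sumFin-mono-≤ n (λ i → f≤g (F.suc i)))

sumFin-const : ∀ n c → sumFin n (λ _ → c) ≡ n * c
sumFin-const zero    c = refl
sumFin-const (suc n) c = cong (c +_) (sumFin-const n c)

countFin≡sumFin-indicator : ∀ n (f : Fin n → Bool) → countFin n f ≡ sumFin n (λ i → indicator (f i))
countFin≡sumFin-indicator zero    f = refl
countFin≡sumFin-indicator (suc n) f =
  cong (indicator (f F.zero) +_) (countFin≡sumFin-indicator n (λ i → f (F.suc i)))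

anyFin⇒∃ : ∀ n (f : Fin n → Bool) → anyFin n f ≡ true → ∃ λ i → f i ≡ true
anyFin⇒∃ (suc n) f any-f with f F.zero in f0
... | true  = F.zero , f0
... | false with anyFin⇒∃ n (λ i → f (F.suc i)) any-f
...   | i , fi = F.suc i , fi

∃⇒anyFin : ∀ n (f : Fin n → Bool) i → f i ≡ true → anyFin n f ≡ true
∃⇒anyFin (suc n) f F.zero    fi rewrite fi = refl
∃⇒anyFin (suc n) f (F.suc i) fi rewrite ∃⇒anyFin n (λ j → f (F.suc j)) i fi = ∨-zeroʳ (f F.zero)

∧-elim : ∀ {a b} → a ∧ b ≡ true → a ≡ true × b ≡ true
∧-elim {true} {true} _ = refl , refl

==-refl : ∀ {n} (v : Fin n) → (v == v) ≡ true
==-refl v with v ≟ v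
... | yes _  = refl
... | no v≢v = ⊥-elim (v≢v refl)

closedNbr-refl : ∀ G v → closedNbr G v v ≡ true
closedNbr-refl G v = cong (_∨ adj G v v) (==-refl v)

closedNbr-adj : ∀ G {u v} → adj G u v ≡ true → closedNbr G u v ≡ true
closedNbr-adj G {u} {v} u~v = trans (cong ((u == v) ∨_) u~v) (∨-zeroʳ (u == v))

dominationNumber-≤ : ∀ G {m} → IsDominationNumber G m →
  ∀ T → IsDominating G T → m ≤ countFin (nV G) T
dominationNumber-≤ G (_ , (_ , S-min) , refl) T T-dom = S-min T T-dom

module CellCounting (X Y Z : Graph) (D : Triple.V3 X Y Z → Bool) {k : ℕ} (π : Fin (nV X) → Fin k) where

  open Triple.Dom.Cells X Y Z D π

  hasZ⇒hasD-neighbour : ∀ i y z → hasZ i y z ≡ true →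
    ∃ λ c → hasD i y c ≡ true × adj Z c z ≡ true
  hasZ⇒hasD-neighbour i y z hz with anyFin⇒∃ (nV X) _ hz
  ... | a , a∈πᵢ,zdom with ∧-elim {π a == i} a∈πᵢ,zdom
  ...   | a∈πᵢ , zdom with anyFin⇒∃ (nV Z) _ zdom
  ...     | c , Dc,c~z with ∧-elim {D (a , y , c)} Dc,c~z
  ...       | Dc , c~z =
    c , ∃⇒anyFin (nV X) (λ a′ → (π a′ == i) ∧ D (a′ , y , c)) a (cong₂ _∧_ a∈πᵢ Dc) , c~z

  -- The cells π_i^{y,z} that are neither maroon nor white.
  zDominator : Fin k → Fin (nV Y) → Fin (nV Z) → Bool
  zDominator i y z = hasD i y z ∨ not (hasZ i y z)

  zDominator-dominates : ∀ i y → IsDominating Z (zDominator i y)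
  zDominator-dominates i y z with hasD i y z in hd | hasZ i y z in hz
  ... | true  | _     = z , cong (_∨ not (hasZ i y z)) hd , closedNbr-refl Z z
  ... | false | false = z , cong₂ (λ d h → d ∨ not h) hd hz , closedNbr-refl Z z
  ... | false | true with hasZ⇒hasD-neighbour i y z hz
  ...   | c , hc , c~z = c , cong (_∨ not (hasZ i y c)) hc , closedNbr-adj Z c~z

  Cell : Set
  Cell = Fin k → Fin (nV Y) → Fin (nV Z) → ℕ

  infixl 6 _⊕_
  _⊕_ : Cell → Cell → Cell
  (f ⊕ g) i y z = f i y z + g i y z

  𝟙 : (Fin k → Fin (nV Y) → Fin (nV Z) → Bool) → Cell
  𝟙 C i y z = indicator (C i y z)

  cellSum : Cell → ℕ
  cellSum f = sumFin k λ i → sumFin (nV Y) λ y → sumFin (nV Z) λ z → f i y z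

  cellSum-distrib-+ : ∀ f g → cellSum (f ⊕ g) ≡ cellSum f + cellSum g
  cellSum-distrib-+ f g =
    trans (sumFin-cong k λ i →
             trans (sumFin-cong (nV Y) λ y → sumFin-distrib-+ (nV Z) (f i y) (g i y))
                   (sumFin-distrib-+ (nV Y) _ _))
          (sumFin-distrib-+ k _ _)

  countCells≡cellSum : ∀ C → countCells C ≡ cellSum (𝟙 C)
  countCells≡cellSum C =
    sumFin-cong k λ i → sumFin-cong (nV Y) λ y → countFin≡sumFin-indicator (nV Z) (C i y)

  countCells-≥ : ∀ {m} C → (∀ i y → m ≤ countFin (nV Z) (C i y)) → countCells C ≥ k * (nV Y * m)
  countCells-≥ {m} C m≤ = begin
    k * (nV Y * m)                         ≡⟨ sym (sumFin-const k _) ⟩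
    sumFin k (λ _ → nV Y * m)              ≡⟨ sumFin-cong k (λ _ → sym (sumFin-const (nV Y) m)) ⟩
    sumFin k (λ _ → sumFin (nV Y) λ _ → m) ≤⟨ sumFin-mono-≤ k (λ i → sumFin-mono-≤ (nV Y) (m≤ i)) ⟩
    countCells C                           ∎
    where open ≤-Reasoning

  non-maroon-white-cells : b′ + g′ + y′ + o′ + r′ + p′ ≡ countCells zDominator
  non-maroon-white-cells = begin
    b′ + g′ + y′ + o′ + r′ + p′
      ≡⟨ cong₂ _+_ (cong₂ _+_ (cong₂ _+_ (cong₂ _+_ (cong₂ _+_
           (countCells≡cellSum blue) (countCells≡cellSum green)) (countCells≡cellSum yellow))
           (countCells≡cellSum orange)) (countCells≡cellSum red)) (countCells≡cellSum pink) ⟩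
    Σ𝟙 blue + Σ𝟙 green + Σ𝟙 yellow + Σ𝟙 orange + Σ𝟙 red + Σ𝟙 pink
      ≡⟨ cong (λ t → t + Σ𝟙 yellow + Σ𝟙 orange + Σ𝟙 red + Σ𝟙 pink)
              (sym (cellSum-distrib-+ (𝟙 blue) (𝟙 green))) ⟩
    cellSum (𝟙 blue ⊕ 𝟙 green) + Σ𝟙 yellow + Σ𝟙 orange + Σ𝟙 red + Σ𝟙 pink
      ≡⟨ cong (λ t → t + Σ𝟙 orange + Σ𝟙 red + Σ𝟙 pink) (sym (cellSum-distrib-+ _ (𝟙 yellow))) ⟩
    cellSum (𝟙 blue ⊕ 𝟙 green ⊕ 𝟙 yellow) + Σ𝟙 orange + Σ𝟙 red + Σ𝟙 pink
      ≡⟨ cong (λ t → t + Σ𝟙 red + Σ𝟙 pink) (sym (cellSum-distrib-+ _ (𝟙 orange))) ⟩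
    cellSum (𝟙 blue ⊕ 𝟙 green ⊕ 𝟙 yellow ⊕ 𝟙 orange) + Σ𝟙 red + Σ𝟙 pink
      ≡⟨ cong (_+ Σ𝟙 pink) (sym (cellSum-distrib-+ _ (𝟙 red))) ⟩
    cellSum (𝟙 blue ⊕ 𝟙 green ⊕ 𝟙 yellow ⊕ 𝟙 orange ⊕ 𝟙 red) + Σ𝟙 pink
      ≡⟨ sym (cellSum-distrib-+ _ (𝟙 pink)) ⟩
    cellSum (𝟙 blue ⊕ 𝟙 green ⊕ 𝟙 yellow ⊕ 𝟙 orange ⊕ 𝟙 red ⊕ 𝟙 pink)
      ≡⟨ sumFin-cong k (λ i → sumFin-cong (nV Y) λ y → sumFin-cong (nV Z) λ z →
           six-colours (hasD i y z) (hasY i y z) (hasZ i y z)) ⟩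
    cellSum (𝟙 zDominator)
      ≡⟨ sym (countCells≡cellSum zDominator) ⟩
    countCells zDominator ∎
    where
    open ≡-Reasoning
    Σ𝟙 : (Fin k → Fin (nV Y) → Fin (nV Z) → Bool) → ℕ
    Σ𝟙 C = cellSum (𝟙 C)
    six-colours : ∀ d h z →
      indicator (d ∧ not h ∧ not z) + indicator (d ∧ h ∧ not z) + indicator (d ∧ not h ∧ z)
      + indicator (d ∧ h ∧ z) + indicator (not d ∧ not h ∧ not z) + indicator (not d ∧ h ∧ not z)
      ≡ indicator (d ∨ not z)
    six-colours true  true  true  = refl
    six-colours true  true  false = refl
    six-colours true  false true  = refl
    six-colours true  false false = refl
    six-colours false true  true  = refl
    six-colours false true  false = refl
    six-colours false false true  = refl
    six-colours false false false = refl

lemma2 : (X Y Z : Graph) → IsSimple X → IsSimple Y → IsSimple Z →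
    (k : ℕ) → IsDominationNumber X k →
    (u : Fin k → Fin (nV X)) → (π : Fin (nV X) → Fin k) →
    (∀ i → π (u i) ≡ i) →
    (∀ a → closedNbr X (u (π a)) a ≡ true) →
    (γZ : ℕ) → IsDominationNumber Z γZ →
    (D : Triple.V3 X Y Z → Bool) → Triple.IsMinDominating3 X Y Z D →
    let open Triple.Dom.Cells X Y Z D π in
    b′ + g′ + y′ + o′ + r′ + p′ ≥ k * γZ * nV Y
lemma2 X Y Z _ _ _ k _ _ π _ _ γZ γZ-def D _ = begin
  k * γZ * nV Y                 ≡⟨ *-assoc k γZ (nV Y) ⟩
  k * (γZ * nV Y)               ≡⟨ cong (k *_) (*-comm γZ (nV Y)) ⟩
  k * (nV Y * γZ)               ≤⟨ countCells-≥ zDominator γZ≤ ⟩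
  countCells zDominator         ≡⟨ sym non-maroon-white-cells ⟩
  b′ + g′ + y′ + o′ + r′ + p′   ∎
  where
  open ≤-Reasoning
  open Triple.Dom.Cells X Y Z D π
  open CellCounting X Y Z D π
  γZ≤ : ∀ i y → γZ ≤ countFin (nV Z) (zDominator i y)
  γZ≤ i y = dominationNumber-≤ Z γZ-def (zDominator i y) (zDominator-dominates i y)
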